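{- For every integer $t\geqslant 3$ and every non-negative integer $d$, every $K_t$-free graph with twin-width at most $d$ admits a proper coloring with $(d+2)^{t-2}$ colors.
   Context: $K_t$-free means having no clique on $t$ vertices. A trigraph has a vertex set, black edges and disjoint red edges; contracting two (not necessarily adjacent) vertices $u,v$ replaces them by a new vertex $z$ with, for each other vertex $x$: $zx$ black if $ux,vx$ both black, red if $x$ is adjacent (black or red) to at least one of $u,v$ but not both via black edges, absent otherwise. A $d$-sequence of an $n$-vertex graph $G$ is a sequence of trigraphs $G=G_n,\ldots,G_1$ whose red graphs have maximum degree at most $d$, with $G_1$ a single vertex and each obtained from the previous by one contraction. The twin-width of $G$ is the minimum $d$ such that $G$ has a $d$-sequence. -}

module Defs where

open import Data.Nat using (ℕ; zero; suc; _≤_)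
open import Data.Fin using (Fin; punchIn; _≟_)
open import Data.Bool using (Bool; true; false)
open import Data.List using (length; filterᵇ)
open import Data.Fin.Base using () renaming (zero to fzero)
open import Data.List using (List)
open import Data.Product using (Σ; _×_; ∃)
open import Relation.Nullary using (¬_; yes; no)
open import Relation.Binary.PropositionalEquality using (_≡_; _≢_)
import Data.List as L
import Data.Fin as F

record Graph (n : ℕ) : Set where
  field
    adj   : Fin n → Fin n → Bool
    sym   : ∀ x y → adj x y ≡ adj y x
    irrefl : ∀ x → adj x x ≡ false
open Graph public

data Label : Set where
  none black red : Label

-- A trigraph on vertex set Fin m: each pair carries a label
-- (black edges and red edges are disjoint by construction).
Trigraph : ℕ → Set
Trigraph m = Fin m → Fin m → Label

toTrigraph : ∀ {n} → Graph n → Trigraph n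
toTrigraph G x y with adj G x y
... | true  = black
... | false = none

-- Label of zx after contracting u,v into z, given labels ux and vx.
merge : Label → Label → Label
merge black black = black
merge none  none  = none
merge _     _     = red

-- The vertices of the result are the old vertices other than v
-- (vertex a : Fin m stands for  punchIn v a ), and the vertex
-- standing for u is the new vertex z.
contract : ∀ {m} → Trigraph (suc m) → (u v : Fin (suc m)) → Trigraph m
contract T u v a b with punchIn v a F.≟ u | punchIn v b F.≟ u
... | yes _ | yes _ = none
... | yes _ | no  _ = merge (T u (punchIn v b)) (T v (punchIn v b))
... | no  _ | yes _ = merge (T u (punchIn v a)) (T v (punchIn v a))
... | no  _ | no  _ = T (punchIn v a) (punchIn v b)

isRed : Label → Bool
isRed red = true
isRed _   = false

redDeg : ∀ {m} → Trigraph m → Fin m → ℕ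
redDeg {m} T a = length (filterᵇ (λ b → isRed (T a b)) (L.allFin m))

RedDegAtMost : ℕ → ∀ {m} → Trigraph m → Set
RedDegAtMost d T = ∀ a → redDeg T a ≤ d

data DSeq (d : ℕ) : (m : ℕ) → Trigraph m → Set where
  done : (T : Trigraph 1) → RedDegAtMost d T → DSeq d 1 T
  step : ∀ {m} (T : Trigraph (suc (suc m))) → RedDegAtMost d T →
         (u v : Fin (suc (suc m))) → u ≢ v →
         DSeq d (suc m) (contract T u v) → DSeq d (suc (suc m)) T

TwinWidthAtMost : ℕ → ∀ {n} → Graph n → Set
TwinWidthAtMost d {n} G = Σ ℕ (λ d' → d' ≤ d × DSeq d' n (toTrigraph G))

KFree : ℕ → ∀ {n} → Graph n → Set
KFree t {n} G =
  ¬ (Σ (Fin t → Fin n) (λ f →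
       ∀ i j → i ≢ j → adj G (f i) (f j) ≡ true))

ProperColoring : ∀ {n} → Graph n → (k : ℕ) → (Fin n → Fin k) → Set
ProperColoring G k c = ∀ x y → adj G x y ≡ true → c x ≢ c y

module Submission where

-- We prove, by induction on s, that every (2+s)-clique-free set S of vertices
-- of G can be properly coloured with (d+2)^s colours (colourSubset); t = 3+s
-- with S = V(G) is the theorem.  For the step we keep, along the d-sequence,
-- the partition π of V(G) into the parts (current vertices) of the trigraph.
-- Call a part tame if its vertices in S have a common neighbour in S, or there
-- is at most one of them; a tame part is (2+s)-clique-free, so the induction
-- hypothesis colours it.  Walking the sequence backwards from one part to the
-- partition into singletons (run), we maintain an outer colour in Fin (d+2)
-- per part and an inner colour per vertex separating every edge of G[S]
-- between tame parts (State).  When a part splits back into u and v and the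
-- merged part was not tame, every edge from it to another part is red, so the
-- at most d red neighbours leave two free outer colours for u and v
-- (Uncontract.Refine).  At the end all parts are singletons, hence tame, and
-- (outer, inner) is a proper colouring with (d+2)·(d+2)^s colours.

open import Defs hiding (sym)
open import Data.Nat
  using (ℕ; zero; suc; _≤_; _<_; _+_; _^_; _∸_; z≤n; s≤s; NonZero; ≢-nonZero; >-nonZero⁻¹)
import Data.Nat.Properties as ℕP
open import Data.Fin using (Fin; toℕ; punchIn; punchOut; combine; inject≤; fromℕ<; _≟_)
  renaming (zero to fzero; suc to fsuc)
import Data.Fin.Properties as FinP
open import Data.Bool using (Bool; true; false; _∧_; T?)
import Data.Bool as Bool
open import Data.Bool.Properties using (∧-identityʳ)
open import Data.Unit using (⊤; tt)
open import Data.Empty using (⊥; ⊥-elim)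
open import Data.Product using (Σ; ∃; _×_; _,_; proj₁; proj₂)
open import Data.Sum using (_⊎_; inj₁; inj₂; [_,_])
open import Data.List using (List; _∷_; length; map; filterᵇ; allFin; lookup)
open import Data.List.Properties using (length-map)
open import Data.List.Membership.Propositional using (_∈_; _∉_)
open import Data.List.Membership.Propositional.Properties using (∈-map⁺; ∈-allFin; ∈-filter⁺)
import Data.List.Membership.DecPropositional as DecMembership
open import Data.List.Relation.Unary.Any using (here; there; index)
open import Data.List.Relation.Unary.Any.Properties using (lookup-index)
open import Function using (_∘_; id)
open import Relation.Nullary using (¬_; Dec; yes; no; does)
open import Relation.Nullary.Decidable using (_×-dec_; _⊎-dec_; _→-dec_)
open import Relation.Binary.PropositionalEquality
  using (_≡_; _≢_; refl; sym; trans; cong; cong₂; subst; subst₂; module ≡-Reasoning)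

missing : ∀ {D} (L : List (Fin D)) → length L < D → ∃ λ c → c ∉ L
missing {D} L |L|<D = FinP.¬∀⟶∃¬ D (_∈ L) (λ c → DecMembership._∈?_ _≟_ c L) notAll
  where
  notAll : ¬ (∀ c → c ∈ L)
  notAll all∈ with FinP.pigeonhole |L|<D (λ c → index (all∈ c))
  ... | i , j , i<j , sameIndex = ℕP.<⇒≢ i<j (cong toℕ i≡j)
    where
    open ≡-Reasoning
    i≡j : i ≡ j
    i≡j = begin
      i                         ≡⟨ lookup-index (all∈ i) ⟩
      lookup L (index (all∈ i)) ≡⟨ cong (lookup L) sameIndex ⟩
      lookup L (index (all∈ j)) ≡⟨ lookup-index (all∈ j) ⟨
      j                         ∎

record TwoAvoiding {D : ℕ} (L : List (Fin D)) : Set where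
  field
    first    : Fin D
    second   : Fin D
    distinct : first ≢ second
    first∉   : first ∉ L
    second∉  : second ∉ L

twoAvoiding : ∀ {D} (L : List (Fin D)) → 2 + length L ≤ D → TwoAvoiding L
twoAvoiding L short with missing L (ℕP.≤-trans (ℕP.n≤1+n _) short)
... | c₁ , c₁∉L with missing (c₁ ∷ L) short
... | c₂ , c₂∉c₁L = record
  { first = c₁ ; second = c₂ ; distinct = λ e → c₂∉c₁L (here (sym e))
  ; first∉ = c₁∉L ; second∉ = c₂∉c₁L ∘ there }

redNeighbours : ∀ {m} → Trigraph m → Fin m → List (Fin m)
redNeighbours {m} T a = filterᵇ (λ b → isRed (T a b)) (allFin m)

red-neighbour : ∀ {m} (T : Trigraph m) {a b} → T a b ≡ red → b ∈ redNeighbours T a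
red-neighbour T {a} {b} isRedEdge =
  ∈-filter⁺ (T? ∘ λ c → isRed (T a c)) (∈-allFin b) (subst (Bool.T ∘ isRed) (sym isRedEdge) tt)

dseq-redDeg : ∀ {d m T} → DSeq d m T → RedDegAtMost d T
dseq-redDeg (done _ bounded)         = bounded
dseq-redDeg (step _ bounded _ _ _ _) = bounded

Compatible : Label → Bool → Set
Compatible black b = b ≡ true
Compatible none  b = b ≡ false
Compatible red   _ = ⊤

-- merge A B is A when A and B agree and red otherwise, so it keeps compatibility.
compatible-mergeˡ : ∀ A B {b} → Compatible A b → Compatible (merge A B) b
compatible-mergeˡ none  none  c = c
compatible-mergeˡ black black c = c
compatible-mergeˡ none  black _ = tt
compatible-mergeˡ none  red   _ = tt
compatible-mergeˡ black none  _ = tt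
compatible-mergeˡ black red   _ = tt
compatible-mergeˡ red   _     _ = tt

merge-comm : ∀ A B → merge A B ≡ merge B A
merge-comm none  none  = refl
merge-comm none  black = refl
merge-comm none  red   = refl
merge-comm black none  = refl
merge-comm black black = refl
merge-comm black red   = refl
merge-comm red   none  = refl
merge-comm red   black = refl
merge-comm red   red   = refl

compatible-mergeʳ : ∀ A B {b} → Compatible B b → Compatible (merge A B) b
compatible-mergeʳ A B {b} c = subst (λ L → Compatible L b) (merge-comm B A) (compatible-mergeˡ B A c)

edge-label : ∀ L → Compatible L true → L ≢ black → L ≡ red
edge-label black _ notBlack = ⊥-elim (notBlack refl)
edge-label red   _ _        = refl

-- T approximates G along π (vertex ↦ part): the label between two distinct
-- parts is compatible with every pair of vertices they contain.
Approximates : ∀ {n m} → Graph n → Trigraph m → (Fin n → Fin m) → Set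
Approximates G T π = ∀ x y → π x ≢ π y → Compatible (T (π x) (π y)) (adj G x y)

approximates-self : ∀ {n} (G : Graph n) → Approximates G (toTrigraph G) id
approximates-self G x y _ with adj G x y
... | true  = refl
... | false = refl

module Contraction {m : ℕ} {u v : Fin (suc m)} (u≢v : u ≢ v) where

  data Position (b : Fin (suc m)) : Set where
    atU       : b ≡ u → Position b
    atV       : b ≡ v → Position b
    elsewhere : b ≢ u → b ≢ v → Position b

  position : ∀ b → Position b
  position b with b ≟ u | b ≟ v
  ... | yes b≡u | _       = atU b≡u
  ... | no _    | yes b≡v = atV b≡v
  ... | no b≢u  | no b≢v  = elsewhere b≢u b≢v

  -- The vertex of  contract T u v  containing b.  As in Defs.contract, vertex
  -- a of the contraction stands for  punchIn v a , and the new vertex for u.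
  collapse : Fin (suc m) → Fin m
  collapse b with b ≟ v
  ... | yes _   = punchOut (u≢v ∘ sym)
  ... | no b≢v  = punchOut (b≢v ∘ sym)

  merged : Fin m
  merged = collapse u

  collapse-outside : ∀ {b} → b ≢ v → punchIn v (collapse b) ≡ b
  collapse-outside {b} b≢v with b ≟ v
  ... | yes b≡v  = ⊥-elim (b≢v b≡v)
  ... | no  b≢v' = FinP.punchIn-punchOut (b≢v' ∘ sym)

  collapse-pair : ∀ {b} → b ≡ u ⊎ b ≡ v → punchIn v (collapse b) ≡ u
  collapse-pair (inj₁ refl) = collapse-outside u≢v
  collapse-pair (inj₂ refl) with v ≟ v
  ... | yes _   = FinP.punchIn-punchOut (u≢v ∘ sym)
  ... | no v≢v  = ⊥-elim (v≢v refl)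

  collapse-merges : ∀ {b} → b ≡ u ⊎ b ≡ v → collapse b ≡ merged
  collapse-merges pair =
    FinP.punchIn-injective v _ _ (trans (collapse-pair pair) (sym (collapse-pair (inj₁ refl))))

  pair-of-collapse : ∀ {b} → punchIn v (collapse b) ≡ u → b ≡ u ⊎ b ≡ v
  pair-of-collapse {b} e with position b
  ... | atU b≡u           = inj₁ b≡u
  ... | atV b≡v           = inj₂ b≡v
  ... | elsewhere b≢u b≢v = ⊥-elim (b≢u (trans (sym (collapse-outside b≢v)) e))

  merged-fibre : ∀ {b} → collapse b ≡ merged → b ≡ u ⊎ b ≡ v
  merged-fibre e = pair-of-collapse (trans (cong (punchIn v) e) (collapse-pair (inj₁ refl)))

  not-merged : ∀ {b} → punchIn v (collapse b) ≢ u → b ≢ u × b ≢ v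
  not-merged ne = ne ∘ collapse-pair ∘ inj₁ , ne ∘ collapse-pair ∘ inj₂

  collapse-injective : ∀ {b b'} → b' ≢ u → b' ≢ v → collapse b ≡ collapse b' → b ≡ b'
  collapse-injective {b} {b'} b'≢u b'≢v e with position b
  ... | atU b≡u = ⊥-elim ([ b'≢u , b'≢v ] (merged-fibre (trans (sym e) (collapse-merges (inj₁ b≡u)))))
  ... | atV b≡v = ⊥-elim ([ b'≢u , b'≢v ] (merged-fibre (trans (sym e) (collapse-merges (inj₂ b≡v)))))
  ... | elsewhere _ b≢v =
    trans (sym (collapse-outside b≢v)) (trans (cong (punchIn v) e) (collapse-outside b'≢v))

  module _ {n} (G : Graph n) (T : Trigraph (suc m)) (π : Fin n → Fin (suc m))
           (approx : Approximates G T π) where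

    merged-versus-outside : ∀ {x y} → π x ≡ u ⊎ π x ≡ v → π y ≢ u → π y ≢ v →
                            Compatible (merge (T u (π y)) (T v (π y))) (adj G x y)
    merged-versus-outside {x} {y} (inj₁ πx≡u) πy≢u _ = compatible-mergeˡ _ _
      (subst (λ a → Compatible (T a (π y)) (adj G x y)) πx≡u
             (approx x y (λ e → πy≢u (trans (sym e) πx≡u))))
    merged-versus-outside {x} {y} (inj₂ πx≡v) _ πy≢v = compatible-mergeʳ _ _
      (subst (λ a → Compatible (T a (π y)) (adj G x y)) πx≡v
             (approx x y (λ e → πy≢v (trans (sym e) πx≡v))))

    approximates-contract : Approximates G (contract T u v) (collapse ∘ π)
    approximates-contract x y ne
      with punchIn v (collapse (π x)) ≟ u | punchIn v (collapse (π y)) ≟ u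
    ... | yes ex | yes ey = ⊥-elim (ne (FinP.punchIn-injective v _ _ (trans ex (sym ey))))
    ... | yes ex | no ny  =
      let πy≢u , πy≢v = not-merged ny in
      subst (λ w → Compatible (merge (T u w) (T v w)) (adj G x y)) (sym (collapse-outside πy≢v))
            (merged-versus-outside (pair-of-collapse ex) πy≢u πy≢v)
    ... | no nx  | yes ey =
      let πx≢u , πx≢v = not-merged nx in
      subst₂ (λ w b → Compatible (merge (T u w) (T v w)) b) (sym (collapse-outside πx≢v)) (Graph.sym G y x)
             (merged-versus-outside (pair-of-collapse ey) πx≢u πx≢v)
    ... | no nx  | no ny  =
      subst₂ (λ a b → Compatible (T a b) (adj G x y))
             (sym (collapse-outside (proj₂ (not-merged nx)))) (sym (collapse-outside (proj₂ (not-merged ny))))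
             (approx x y (ne ∘ cong collapse))

module Colouring {n : ℕ} (G : Graph n) (d : ℕ) where

  CliqueFreeIn : ℕ → (Fin n → Bool) → Set
  CliqueFreeIn t S = ¬ (Σ (Fin t → Fin n) λ f →
    (∀ i → S (f i) ≡ true) × (∀ i j → i ≢ j → adj G (f i) (f j) ≡ true))

  EdgeIn : (Fin n → Bool) → Fin n → Fin n → Set
  EdgeIn S x y = S x ≡ true × S y ≡ true × adj G x y ≡ true

  edge-sym : ∀ {S x y} → EdgeIn S x y → EdgeIn S y x
  edge-sym {x = x} {y} (Sx , Sy , xy) = Sy , Sx , trans (Graph.sym G y x) xy

  ProperOn : (Fin n → Bool) → (k : ℕ) → (Fin n → Fin k) → Set
  ProperOn S k c = ∀ {x y} → EdgeIn S x y → c x ≢ c y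

  edgeless-colouring : ∀ S → CliqueFreeIn 2 S → ProperOn S 1 (λ _ → fzero)
  edgeless-colouring S noEdge {x} {y} (Sx , Sy , xy) _ = noEdge (pair , inS , adjacent)
    where
    pair : Fin 2 → Fin n
    pair fzero    = x
    pair (fsuc _) = y
    inS : ∀ i → S (pair i) ≡ true
    inS fzero    = Sx
    inS (fsuc _) = Sy
    adjacent : ∀ i j → i ≢ j → adj G (pair i) (pair j) ≡ true
    adjacent fzero        fzero        i≢j = ⊥-elim (i≢j refl)
    adjacent fzero        (fsuc _)     _   = xy
    adjacent (fsuc _)     fzero        _   = trans (Graph.sym G y x) xy
    adjacent (fsuc fzero) (fsuc fzero) i≢j = ⊥-elim (i≢j refl)

  instance
    d+2-nonZero : NonZero (d + 2)
    d+2-nonZero = ≢-nonZero (ℕP.m+1+n≢0 d)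

  module Layer (s : ℕ) (S : Fin n → Bool) (cliqueFree : CliqueFreeIn (3 + s) S)
               (colourIH : ∀ S' → CliqueFreeIn (2 + s) S' →
                           Σ (Fin n → Fin ((d + 2) ^ s)) (ProperOn S' ((d + 2) ^ s))) where

    K : ℕ
    K = (d + 2) ^ s

    Tame : (Fin n → Set) → Set
    Tame P = (∃ λ y → S y ≡ true × (∀ x → S x ≡ true → P x → adj G x y ≡ true))
           ⊎ (∃ λ y → ∀ x → S x ≡ true → P x → x ≡ y)

    tame-mono : ∀ {P Q : Fin n → Set} → Tame P → (∀ z → S z ≡ true → Q z → P z) → Tame Q
    tame-mono (inj₁ (y , Sy , dominated)) Q⊆P = inj₁ (y , Sy , λ x Sx Qx → dominated x Sx (Q⊆P x Sx Qx))
    tame-mono (inj₂ (y , single))         Q⊆P = inj₂ (y , λ x Sx Qx → single x Sx (Q⊆P x Sx Qx))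

    TamePart : ∀ {m} → (Fin n → Fin m) → Fin m → Set
    TamePart π a = Tame (λ x → π x ≡ a)

    tamePart? : ∀ {m} (π : Fin n → Fin m) a → Dec (TamePart π a)
    tamePart? π a =
      FinP.any? (λ y → (S y Bool.≟ true) ×-dec
        FinP.all? (λ x → (S x Bool.≟ true) →-dec ((π x ≟ a) →-dec (adj G x y Bool.≟ true))))
      ⊎-dec
      FinP.any? (λ y → FinP.all? (λ x → (S x Bool.≟ true) →-dec ((π x ≟ a) →-dec (x ≟ y))))

    singleton-tame : ∀ x → TamePart id x
    singleton-tame x = inj₂ (x , λ _ _ e → e)

    within : ∀ {m} → (Fin n → Fin m) → Fin m → Fin n → Bool
    within π a x = S x ∧ does (π x ≟ a)

    within-intro : ∀ {m} (π : Fin n → Fin m) {a x} → S x ≡ true → π x ≡ a → within π a x ≡ true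
    within-intro π {a} {x} Sx πx≡a with π x ≟ a
    ... | yes _     = trans (∧-identityʳ (S x)) Sx
    ... | no πx≢a   = ⊥-elim (πx≢a πx≡a)

    within-elim : ∀ {m} (π : Fin n → Fin m) {a} x → within π a x ≡ true → S x ≡ true × π x ≡ a
    within-elim π {a} x w with S x | π x ≟ a
    ... | true | yes πx≡a = refl , πx≡a
    within-elim π x () | true  | no _
    within-elim π x () | false | _

    -- A tame part is (2+s)-clique-free: a clique in a dominated part extends by
    -- the dominating vertex, and one vertex carries no 2-clique.
    tame-cliqueFree : ∀ {m} (π : Fin n → Fin m) a → TamePart π a → CliqueFreeIn (2 + s) (within π a)
    tame-cliqueFree π a (inj₁ (y , Sy , dominated)) (f , inPart , clique) =
      cliqueFree (withApex , inS , clique')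
      where
      toApex : ∀ i → adj G (f i) y ≡ true
      toApex i = let Sf , πf≡a = within-elim π (f i) (inPart i) in dominated (f i) Sf πf≡a
      withApex : Fin (3 + s) → Fin n
      withApex fzero    = y
      withApex (fsuc i) = f i
      inS : ∀ i → S (withApex i) ≡ true
      inS fzero    = Sy
      inS (fsuc i) = proj₁ (within-elim π (f i) (inPart i))
      clique' : ∀ i j → i ≢ j → adj G (withApex i) (withApex j) ≡ true
      clique' fzero    fzero    i≢j = ⊥-elim (i≢j refl)
      clique' fzero    (fsuc j) _   = trans (Graph.sym G y (f j)) (toApex j)
      clique' (fsuc i) fzero    _   = toApex i
      clique' (fsuc i) (fsuc j) i≢j = clique i j (i≢j ∘ cong fsuc)
    tame-cliqueFree π a (inj₂ (y , single)) (f , inPart , clique) = true≢false loop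
      where
      open ≡-Reasoning
      onlyY : ∀ i → f i ≡ y
      onlyY i = let Sf , πf≡a = within-elim π (f i) (inPart i) in single (f i) Sf πf≡a
      loop : true ≡ false
      loop = begin
        true                             ≡⟨ clique fzero (fsuc fzero) (λ ()) ⟨
        adj G (f fzero) (f (fsuc fzero)) ≡⟨ cong₂ (adj G) (onlyY fzero) (onlyY (fsuc fzero)) ⟩
        adj G y y                        ≡⟨ irrefl G y ⟩
        false                            ∎
      true≢false : true ≢ false
      true≢false ()

    recolour : ∀ {m} (π : Fin n → Fin m) a → (Fin n → Fin K) → Fin n → Fin K
    recolour π a old with tamePart? π a
    ... | yes tame = proj₁ (colourIH (within π a) (tame-cliqueFree π a tame))
    ... | no _     = old

    recolour-proper : ∀ {m} (π : Fin n → Fin m) a old → TamePart π a →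
                      ∀ {x y} → EdgeIn S x y → π x ≡ a → π y ≡ a →
                      recolour π a old x ≢ recolour π a old y
    recolour-proper π a old tame (Sx , Sy , xy) πx≡a πy≡a with tamePart? π a
    ... | yes tame' = proj₂ (colourIH _ (tame-cliqueFree π a tame'))
                        (within-intro π Sx πx≡a , within-intro π Sy πy≡a , xy)
    ... | no ¬tame  = ⊥-elim (¬tame tame)

    record State {m} (π : Fin n → Fin m) : Set where
      field
        outer     : Fin m → Fin (d + 2)
        inner     : Fin n → Fin K
        separated : ∀ {x y} → EdgeIn S x y → TamePart π (π x) → TamePart π (π y) →
                    outer (π x) ≡ outer (π y) → inner x ≢ inner y

    only : (i : Fin 1) → i ≡ fzero
    only fzero = refl

    initial : (π : Fin n → Fin 1) → State π
    initial π = record { outer = λ _ → anyOuter ; inner = recolour π fzero anyInner ; separated = onePart }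
      where
      anyOuter : Fin (d + 2)
      anyOuter = fromℕ< (>-nonZero⁻¹ (d + 2))
      anyInner : Fin n → Fin K
      anyInner _ = fromℕ< (ℕP.m^n>0 (d + 2) s)
      onePart : ∀ {x y} → EdgeIn S x y → TamePart π (π x) → TamePart π (π y) →
                anyOuter ≡ anyOuter → recolour π fzero anyInner x ≢ recolour π fzero anyInner y
      onePart {x} {y} e tame _ _ =
        recolour-proper π fzero anyInner (subst (TamePart π) (only (π x)) tame) e (only (π x)) (only (π y))

    module Uncontract {m} {u v : Fin (suc (suc m))} (u≢v : u ≢ v) (π : Fin n → Fin (suc (suc m))) where
      open Contraction u≢v public

      π' : Fin n → Fin (suc m)
      π' = collapse ∘ π

      tame-outside : ∀ {x} → π x ≢ u → π x ≢ v → TamePart π (π x) → TamePart π' (π' x)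
      tame-outside πx≢u πx≢v tame = tame-mono tame (λ _ _ e → collapse-injective πx≢u πx≢v e)

      tame-contract : TamePart π' merged → ∀ x → TamePart π (π x) → TamePart π' (π' x)
      tame-contract tameMerged x tame with position (π x)
      ... | atU e           = subst (TamePart π') (sym (collapse-merges (inj₁ e))) tameMerged
      ... | atV e           = subst (TamePart π') (sym (collapse-merges (inj₂ e))) tameMerged
      ... | elsewhere nu nv = tame-outside nu nv tame

      keep : TamePart π' merged → State π' → State π
      keep tameMerged coarse = record
        { outer     = outer ∘ collapse
        ; inner     = inner
        ; separated = λ e tx ty → separated e (tame-contract tameMerged _ tx) (tame-contract tameMerged _ ty) }
        where open State coarse

      -- Otherwise u and v get two outer colours, distinct from each other and
      -- from those of all red neighbours of the merged vertex in the contraction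
      -- C, and their vertices are recoloured by the induction hypothesis.
      module Refine (C : Trigraph (suc m)) (redDeg≤d : RedDegAtMost d C)
                    (approx : Approximates G C π') (wild : ¬ TamePart π' merged)
                    (coarse : State π') where
        open State coarse renaming (outer to outer'; inner to inner'; separated to separated')

        forbidden : List (Fin (d + 2))
        forbidden = map outer' (redNeighbours C merged)

        forbidden-short : 2 + length forbidden ≤ d + 2
        forbidden-short = subst (2 + length forbidden ≤_) (ℕP.+-comm 2 d)
          (ℕP.+-monoʳ-≤ 2 (subst (_≤ d) (sym (length-map outer' (redNeighbours C merged))) (redDeg≤d merged)))

        open TwoAvoiding (twoAvoiding forbidden forbidden-short)
          renaming (first to colourU; second to colourV; first∉ to colourU∉; second∉ to colourV∉)

        outer : Fin (suc (suc m)) → Fin (d + 2)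
        outer b with position b
        ... | atU _         = colourU
        ... | atV _         = colourV
        ... | elsewhere _ _ = outer' (collapse b)

        inner : Fin n → Fin K
        inner x with position (π x)
        ... | atU _         = recolour π u inner' x
        ... | atV _         = recolour π v inner' x
        ... | elsewhere _ _ = inner' x

        -- An edge from the merged pair to another part is red in C, since black
        -- would make the merged part dominated; so that part's colour is forbidden.
        crossing-forbidden : ∀ {x y} → EdgeIn S x y → π x ≡ u ⊎ π x ≡ v → π y ≢ u → π y ≢ v →
                             outer' (π' y) ∈ forbidden
        crossing-forbidden {x} {y} (_ , Sy , xy) pair πy≢u πy≢v =
          ∈-map⁺ outer' (red-neighbour C (edge-label _ compatible notBlack))
          where
          apart : ∀ {z} → π' z ≡ merged → π' z ≢ π' y
          apart πz≡merged e = [ πy≢u , πy≢v ] (merged-fibre (trans (sym e) πz≡merged))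
          compatible : Compatible (C merged (π' y)) true
          compatible = subst₂ (λ a b → Compatible (C a (π' y)) b) (collapse-merges pair) xy
                              (approx x y (apart (collapse-merges pair)))
          notBlack : C merged (π' y) ≢ black
          notBlack isBlack = wild (inj₁ (y , Sy , λ z _ πz≡merged →
            subst (λ L → Compatible L (adj G z y)) (trans (cong (λ a → C a (π' y)) πz≡merged) isBlack)
                  (approx z y (apart πz≡merged))))

        -- Edges inside u or inside v are separated by the recolouring, edges between
        -- u, v and other parts by the outer colours, and all others as before.
        separated : ∀ {x y} → EdgeIn S x y → TamePart π (π x) → TamePart π (π y) →
                    outer (π x) ≡ outer (π y) → inner x ≢ inner y
        separated {x} {y} e tx ty same with position (π x) | position (π y)
        ... | atU ex | atU ey = recolour-proper π u inner' (subst (TamePart π) ex tx) e ex ey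
        ... | atV ex | atV ey = recolour-proper π v inner' (subst (TamePart π) ex tx) e ex ey
        ... | atU _  | atV _  = λ _ → distinct same
        ... | atV _  | atU _  = λ _ → distinct (sym same)
        ... | atU ex | elsewhere nu nv =
          λ _ → colourU∉ (subst (_∈ forbidden) (sym same) (crossing-forbidden e (inj₁ ex) nu nv))
        ... | atV ex | elsewhere nu nv =
          λ _ → colourV∉ (subst (_∈ forbidden) (sym same) (crossing-forbidden e (inj₂ ex) nu nv))
        ... | elsewhere nu nv | atU ey =
          λ _ → colourU∉ (subst (_∈ forbidden) same (crossing-forbidden (edge-sym e) (inj₁ ey) nu nv))
        ... | elsewhere nu nv | atV ey =
          λ _ → colourV∉ (subst (_∈ forbidden) same (crossing-forbidden (edge-sym e) (inj₂ ey) nu nv))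
        ... | elsewhere nu nv | elsewhere nu' nv' =
          separated' e (tame-outside nu nv tx) (tame-outside nu' nv' ty) same

        refined : State π
        refined = record { outer = outer ; inner = inner ; separated = separated }

    run : ∀ {m T} → DSeq d m T → (π : Fin n → Fin m) → Approximates G T π → State π
    run (done _ _) π _ = initial π
    run (step T _ u v u≢v seq) π approx = uncontract (tamePart? π' merged)
      where
      open Uncontract u≢v π
      approx' : Approximates G (contract T u v) π'
      approx' = approximates-contract G T π approx
      coarse : State π'
      coarse = run seq π' approx'
      uncontract : Dec (TamePart π' merged) → State π
      uncontract (yes tameMerged) = keep tameMerged coarse
      uncontract (no wild)        = Refine.refined (contract T u v) (dseq-redDeg seq) approx' wild coarse

  colourSubset : ∀ s S → CliqueFreeIn (2 + s) S → DSeq d n (toTrigraph G) →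
                 Σ (Fin n → Fin ((d + 2) ^ s)) (ProperOn S ((d + 2) ^ s))
  colourSubset zero    S noEdge _   = (λ _ → fzero) , edgeless-colouring S noEdge
  colourSubset (suc s) S cliqueFree seq = colour , proper
    where
    open Layer s S cliqueFree (λ S' cliqueFree' → colourSubset s S' cliqueFree' seq)
    open State (run seq id (approximates-self G))
    colour : Fin n → Fin ((d + 2) ^ suc s)
    colour x = combine (outer x) (inner x)
    proper : ProperOn S ((d + 2) ^ suc s) colour
    proper {x} {y} e same = separated e (singleton-tame x) (singleton-tame y) (proj₁ split) (proj₂ split)
      where
      split : outer x ≡ outer y × inner x ≡ inner y
      split = FinP.combine-injective (outer x) (inner x) (outer y) (inner y) same

theorem18 : (t : ℕ) → 3 ≤ t → (d n : ℕ) → (G : Graph n) →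
    KFree t G → TwinWidthAtMost d G →
    Σ (Fin n → Fin ((d + 2) ^ (t ∸ 2))) (λ c → ProperColoring G ((d + 2) ^ (t ∸ 2)) c)
theorem18 (suc (suc (suc s))) (s≤s (s≤s (s≤s z≤n))) d n G Kt-free (d' , d'≤d , seq) =
  (λ x → inject≤ (colour x) fewer) ,
  λ x y xy e → proper {x} {y} (refl , refl , xy) (FinP.inject≤-injective fewer fewer _ _ e)
  where
  open Colouring G d'
  allVertices : CliqueFreeIn (3 + s) (λ _ → true)
  allVertices (f , _ , clique) = Kt-free (f , clique)
  coloured : Σ (Fin n → Fin ((d' + 2) ^ suc s)) (ProperOn (λ _ → true) ((d' + 2) ^ suc s))
  coloured = colourSubset (suc s) (λ _ → true) allVertices seq
  colour : Fin n → Fin ((d' + 2) ^ suc s)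
  colour = proj₁ coloured
  proper : ProperOn (λ _ → true) ((d' + 2) ^ suc s) colour
  proper = proj₂ coloured
  fewer : (d' + 2) ^ suc s ≤ (d + 2) ^ suc s
  fewer = ℕP.^-monoˡ-≤ (suc s) (ℕP.+-monoˡ-≤ 2 d'≤d)
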